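{- Let $q$ be a prime power and $L:\mathbb{F}_q^m\to\mathbb{F}_q^r$ a linear map given by a full-rank matrix $A\in\mathbb{Z}^{r\times m}$ with entries coprime to $q$ such that $\mathcal{S}_L(\mathbb{F}_q^n)\ne\emptyset$. Let $t\ge-1$ and suppose $L$ is admissible (i.e. $t\ge0$, or $t=-1$ and $L$ is invariant). Then, as $n\to\infty$, $|\mathcal{S}^t_L(\mathbb{F}_q^n)|=|\mathcal{S}_L(\mathbb{F}_q^n)|\,(1+o(1))$.
   Context: $\mathcal{S}'_L(T)=\{{\bf s}\in T^m: A\cdot{\bf s}={\bf 0}\}$ for $T\subseteq\mathbb{F}_q^n$, and $\mathcal{S}_L(T)$ its subset of tuples with pairwise distinct entries. Let $e_0=0$ and $e_j$ the unit vectors of $\mathbb{F}_q^n$; an affine map $\varphi:\mathbb{F}_q^k\to\mathbb{F}_q^n$ is $t$-fixed ($t\ge0$) if $\varphi(e_j)=e_j$ for $0\le j\le t$, every affine map being $(-1)$-fixed; a $t$-fixed $k$-dimensional subspace is the image of an injective $t$-fixed affine map $\mathbb{F}_q^k\to\mathbb{F}_q^n$; $t^+=\max\{t,0\}$. For ${\bf s}\in\mathcal{S}'_L(\mathbb{F}_q^n)$, $\dim_t({\bf s})$ is the smallest $k\ge t^+$ such that a $t$-fixed $k$-dimensional subspace of $\mathbb{F}_q^n$ contains all entries of ${\bf s}$; $\dim_t(L)$ is the maximum of $\dim_t({\bf s})$ over all solutions in all $\mathbb{F}_q^n$, $n\ge t^+$. $L$ is invariant if translating all entries of a solution by any $a\in\mathbb{F}_q^n$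 gives a solution. $\mathcal{S}^t_L(T)=\{{\bf s}\in\mathcal{S}'_L(T):\dim_t({\bf s})=\dim_t(L)\}$. -}

module Defs where

open import Level using (0ℓ)
open import Data.Nat as ℕ using (ℕ; zero; suc; _≤_; _<_; _^_)
open import Data.Nat.Primality using (Prime)
open import Data.Integer as ℤ using (ℤ; +_; -[1+_])
open import Data.Fin using (Fin; toℕ)
open import Data.Vec using (Vec; lookup; tabulate; map; zipWith)
open import Data.Bool using (if_then_else_)
open import Data.Product using (Σ; ∃; _×_; _,_)
open import Data.Sum using (_⊎_)
open import Relation.Binary.PropositionalEquality using (_≡_; _≢_)
open import Relation.Nullary using (¬_)
open import Algebra.Structures using (IsCommutativeRing)
open import Function.Bundles using (_↔_)

IsPrimePower : ℕ → Set
IsPrimePower q = Σ ℕ λ p → Σ ℕ λ k → Prime p × 1 ≤ k × q ≡ p ^ k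

record FiniteField : Set₁ where
  infixl 6 _+_
  infixl 7 _*_
  field
    Carrier : Set
    _+_ _*_ : Carrier → Carrier → Carrier
    -_ : Carrier → Carrier
    0# 1# : Carrier
    isCommutativeRing : IsCommutativeRing _≡_ _+_ _*_ -_ 0# 1#
    0≢1 : 0# ≢ 1#
    inverse : ∀ x → x ≢ 0# → Σ Carrier λ y → x * y ≡ 1#
    size : ℕ
    enumeration : Fin size ↔ Carrier

module _ (F : FiniteField) where
  open FiniteField F

  Vecs : ℕ → Set
  Vecs n = Vec Carrier n

  ∑ : ∀ {k} → (Fin k → Carrier) → Carrier
  ∑ {zero} f = 0#
  ∑ {suc k} f = f Fin.zero + ∑ (λ i → f (Fin.suc i))
    where import Data.Fin as Fin

  fromℕ : ℕ → Carrier
  fromℕ zero = 0#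
  fromℕ (suc n) = 1# + fromℕ n

  fromℤ : ℤ → Carrier
  fromℤ (+ n) = fromℕ n
  fromℤ -[1+ n ] = - fromℕ (suc n)

  _+ᵥ_ : ∀ {n} → Vecs n → Vecs n → Vecs n
  _+ᵥ_ = zipWith _+_

  -- e_0 = 0 and e_j (j ≥ 1) the j-th unit vector of F^n
  unit : (n : ℕ) → ℕ → Vecs n
  unit n j = tabulate λ i → if j ℕ.≡ᵇ suc (toℕ i) then 1# else 0#

  _⁺ : ℤ → ℕ
  (+ n) ⁺ = n
  -[1+ n ] ⁺ = 0

  IsSolution : ∀ {r m n} → (Fin r → Fin m → ℤ) → Vec (Vecs n) m → Set
  IsSolution {r} {m} {n} A s =
    ∀ (i : Fin r) (c : Fin n) → ∑ (λ j → fromℤ (A i j) * lookup (lookup s j) c) ≡ 0#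

  IsDistinctSolution : ∀ {r m n} → (Fin r → Fin m → ℤ) → Vec (Vecs n) m → Set
  IsDistinctSolution A s =
    IsSolution A s × (∀ i j → lookup s i ≡ lookup s j → i ≡ j)

  FullRank : ∀ {r m} → (Fin r → Fin m → ℤ) → Set
  FullRank {r} {m} A =
    ∀ (c : Fin r → Carrier) → (∀ j → ∑ (λ i → c i * fromℤ (A i j)) ≡ 0#) → ∀ i → c i ≡ 0#

  Invariant : ∀ {r m} → (Fin r → Fin m → ℤ) → Set
  Invariant {r} {m} A =
    ∀ (n : ℕ) (s : Vec (Vecs n) m) → IsSolution A s → ∀ (a : Vecs n) →
      IsSolution A (map (_+ᵥ a) s)

  record Affine (k n : ℕ) : Set where
    field
      M : Fin n → Fin k → Carrier
      b : Fin n → Carrier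

  apply : ∀ {k n} → Affine k n → Vecs k → Vecs n
  apply φ x = tabulate λ i → ∑ (λ j → Affine.M φ i j * lookup x j) + Affine.b φ i

  InjectiveAff : ∀ {k n} → Affine k n → Set
  InjectiveAff φ = ∀ x y → apply φ x ≡ apply φ y → x ≡ y

  TFixed : ∀ {k n} → ℤ → Affine k n → Set
  TFixed {k} {n} t φ = ∀ (j : ℕ) → + j ℤ.≤ t → apply φ (unit k j) ≡ unit n j

  -- a t-fixed k-dimensional subspace (k ≥ t^+) contains all entries of s
  Fits : ∀ {m n} → ℤ → Vec (Vecs n) m → ℕ → Set
  Fits {m} {n} t s k =
    (t ⁺) ≤ k × Σ (Affine k n) λ φ → InjectiveAff φ × TFixed t φ ×
      (∀ (j : Fin m) → Σ (Vecs k) λ x → apply φ x ≡ lookup s j)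

  IsDim : ∀ {m n} → ℤ → Vec (Vecs n) m → ℕ → Set
  IsDim t s d = Fits t s d × (∀ k → k < d → ¬ Fits t s k)

  IsDimL : ∀ {r m} → ℤ → (Fin r → Fin m → ℤ) → ℕ → Set
  IsDimL {r} {m} t A D =
    (∀ (n : ℕ) → (t ⁺) ≤ n → ∀ (s : Vec (Vecs n) m) → IsSolution A s →
       ∀ d → IsDim t s d → d ≤ D)
    × Σ ℕ λ n → (t ⁺) ≤ n × Σ (Vec (Vecs n) m) λ s → IsSolution A s × IsDim t s D

  -- S^t_L(F^n) for D = dim_t(L)
  IsTSolution : ∀ {r m n} → ℤ → (Fin r → Fin m → ℤ) → ℕ → Vec (Vecs n) m → Set
  IsTSolution t A D s = IsSolution A s × IsDim t s D

  Admissible : ∀ {r m} → ℤ → (Fin r → Fin m → ℤ) → Set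
  Admissible t A = (+ 0 ℤ.≤ t) ⊎ (t ≡ -[1+ 0 ] × Invariant A)

HasCard : {X : Set} → (X → Set) → ℕ → Set
HasCard {X} P c =
  Σ (Fin c → X) λ f → (∀ i j → f i ≡ f j → i ≡ j) × (∀ i → P (f i)) × (∀ x → P x → ∃ λ i → f i ≡ x)

module Submission where

-- A solution s ∈ (F^n)^m of A·s = 0 is the same as an n-tuple of columns in the kernel K of A. Call s
-- saturated if every vector of K occurs as a column of s at a coordinate ≥ t⁺. If s is saturated, every
-- other solution s₀ is the image of s under a linear map fixing e₀, …, e_t; composing an injective t-fixed
-- affine map that fits s with it gives a t-fixed map fitting s₀, which is made injective by repeatedly
-- deleting a coordinate along which it has a kernel vector (never a fixed one). So dim_t(s) ≥ dim_t(s₀) for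
-- all s₀, i.e. saturated solutions have dimension dim_t(L); they also have distinct entries once some
-- solution does. Hence both S^t_L(F^n) and S_L(F^n) lie between the saturated solutions and all solutions,
-- and the unsaturated ones number at most |K| · |K|^{t⁺} · (|K| − 1)^{n − t⁺} = o(|K|^n).

open import Level using (0ℓ)
open import Algebra.Bundles using (CommutativeRing)
open import Data.Bool using (if_then_else_)
open import Data.Empty using (⊥-elim)
open import Data.Fin as Fin using (Fin; toℕ; punchIn)
import Data.Fin.Properties as Finₚ
open import Data.Integer as ℤ using (ℤ; -[1+_]; ∣_∣)
open import Data.List as List using (List; []; _∷_; length; filter; cartesianProductWith)
import Data.List.Properties as Listₚ
open import Data.List.Membership.Propositional using (_∈_; lose)
import Data.List.Membership.Propositional.Properties as ∈ₚ
open import Data.List.Relation.Unary.All as All using (All; []; _∷_)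
import Data.List.Relation.Unary.All.Properties as Allₚ
open import Data.List.Relation.Unary.AllPairs using ([]; _∷_)
open import Data.List.Relation.Unary.Any as Any using (Any; here; there)
import Data.List.Relation.Unary.Any.Properties as Anyₚ
open import Data.List.Relation.Unary.Unique.Propositional using (Unique)
import Data.List.Relation.Unary.Unique.Propositional.Properties as Uniqueₚ
open import Data.Nat as ℕ using (ℕ; zero; suc; pred; _≤_; _<_; _≤?_; _<?_; z≤n; s≤s)
open import Data.Nat.Coprimality using (Coprime)
open import Data.Nat.Induction using (<-rec)
import Data.Nat.Properties as ℕₚ
open import Data.Nat.Tactic.RingSolver using (solve-∀)
open import Data.Product using (Σ; _×_; _,_; proj₁; proj₂)
open import Data.Sum using (_⊎_; inj₁; inj₂; [_,_]′)
open import Data.Vec as Vec using (Vec; []; _∷_; lookup; tabulate)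
import Data.Vec.Properties as Vecₚ
open import Function using (_∘_; case_of_; Inverse; Injection)
open import Function.Properties.Inverse using (↔-sym; ↔⇒↣)
open import Relation.Binary.PropositionalEquality
  using (_≡_; _≢_; refl; sym; trans; cong; cong₂; subst; module ≡-Reasoning)
open import Relation.Nullary using (¬_; Dec; yes; no; ¬?; contradiction)
open import Relation.Nullary.Decidable using (decidable-stable; _×-dec_; _→-dec_)
open import Relation.Unary using (Decidable)
open import Relation.Unary.Properties using (∁?; U?)

open import Defs

private variable
  X Y Z : Set

lookup-ext : ∀ {n} {x y : Vec X n} → (∀ i → lookup x i ≡ lookup y i) → x ≡ y
lookup-ext {x = x} {y} h =
  trans (sym (Vecₚ.tabulate∘lookup x)) (trans (Vecₚ.tabulate-cong h) (Vecₚ.tabulate∘lookup y))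

lookup-injective : {xs : List X} → Unique xs → ∀ i j → List.lookup xs i ≡ List.lookup xs j → i ≡ j
lookup-injective (_ ∷ _) Fin.zero Fin.zero _ = refl
lookup-injective (x∉ ∷ _) Fin.zero (Fin.suc j) e = contradiction e (All.lookup x∉ (∈ₚ.∈-lookup j))
lookup-injective (x∉ ∷ _) (Fin.suc i) Fin.zero e = contradiction (sym e) (All.lookup x∉ (∈ₚ.∈-lookup i))
lookup-injective (_ ∷ u) (Fin.suc i) (Fin.suc j) e = cong Fin.suc (lookup-injective u i j e)

module _ {P : X → Set} {c : ℕ} (card : HasCard P c) where
  private
    f = proj₁ card
    f-injective = proj₁ (proj₂ card)
    f-sound = proj₁ (proj₂ (proj₂ card))
    f-complete = proj₂ (proj₂ (proj₂ card))

  HasCard⇒length≤ : {xs : List X} → Unique xs → All P xs → length xs ≤ c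
  HasCard⇒length≤ {xs} unique all = Finₚ.injective⇒≤ index-injective
    where
    index : Fin (length xs) → Fin c
    index i = proj₁ (f-complete _ (All.lookup all (∈ₚ.∈-lookup i)))
    index-spec : ∀ i → f (index i) ≡ List.lookup xs i
    index-spec i = proj₂ (f-complete _ (All.lookup all (∈ₚ.∈-lookup i)))
    index-injective : ∀ {i j} → index i ≡ index j → i ≡ j
    index-injective {i} {j} e =
      lookup-injective unique i j (trans (sym (index-spec i)) (trans (cong f e) (index-spec j)))

  HasCard⇒≤length : (xs : List X) → (∀ {x} → P x → x ∈ xs) → c ≤ length xs
  HasCard⇒≤length xs complete = Finₚ.injective⇒≤ position-injective
    where
    position : Fin c → Fin (length xs)
    position i = Any.index (complete (f-sound i))
    position-injective : ∀ {i j} → position i ≡ position j → i ≡ j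
    position-injective {i} {j} e = f-injective i j
      (trans (Anyₚ.lookup-index (complete (f-sound i)))
        (trans (cong (List.lookup xs) e) (sym (Anyₚ.lookup-index (complete (f-sound j))))))

∈⇒1≤length : ∀ {x : X} {xs} → x ∈ xs → 1 ≤ length xs
∈⇒1≤length (here _) = s≤s z≤n
∈⇒1≤length (there _) = s≤s z≤n

vectors : List X → (n : ℕ) → List (Vec X n)
vectors xs zero = [] ∷ []
vectors xs (suc n) = cartesianProductWith _∷_ xs (vectors xs n)

∈-vectors⁺ : (xs : List X) {n : ℕ} (v : Vec X n) → (∀ i → lookup v i ∈ xs) → v ∈ vectors xs n
∈-vectors⁺ xs [] _ = here refl
∈-vectors⁺ xs (x ∷ v) h =
  ∈ₚ.∈-cartesianProductWith⁺ _∷_ (h Fin.zero) (∈-vectors⁺ xs v (λ i → h (Fin.suc i)))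

∈-vectors⁻ : (xs : List X) {n : ℕ} (v : Vec X n) → v ∈ vectors xs n → ∀ i → lookup v i ∈ xs
∈-vectors⁻ xs {suc n} v v∈ i with ∈ₚ.∈-cartesianProductWith⁻ _∷_ xs (vectors xs n) v∈
∈-vectors⁻ xs .(x ∷ w) _ Fin.zero | x , w , x∈ , w∈ , refl = x∈
∈-vectors⁻ xs .(x ∷ w) _ (Fin.suc i) | x , w , x∈ , w∈ , refl = ∈-vectors⁻ xs w w∈ i

vectors⁺ : {xs : List X} → Unique xs → ∀ n → Unique (vectors xs n)
vectors⁺ u zero = [] ∷ []
vectors⁺ u (suc n) = Uniqueₚ.cartesianProductWith⁺ _∷_ ∷-injective u (vectors⁺ u n)
  where
  ∷-injective : ∀ {x y : X} {v w : Vec X n} → x ∷ v ≡ y ∷ w → x ≡ y × v ≡ w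
  ∷-injective refl = refl , refl

record Enumeration (X : Set) : Set where
  field
    elements : List X
    complete : ∀ x → x ∈ elements

open Enumeration

module _ (E : Enumeration X) {P : X → Set} (P? : Decidable P) where

  ∃? : Dec (Σ X P)
  ∃? with Any.any? P? (elements E)
  ... | yes p = yes (Any.satisfied p)
  ... | no ¬p = no λ (x , px) → ¬p (lose (complete E x) px)

  ∀? : Dec (∀ x → P x)
  ∀? with All.all? P? (elements E)
  ... | yes p = yes λ x → All.lookup p (complete E x)
  ... | no ¬p = no λ p → ¬p (All.tabulate (λ {x} _ → p x))

¬∀⇒∃¬ : (E : Enumeration X) {P : X → Set} → Decidable P → ¬ (∀ x → P x) → Σ X (λ x → ¬ P x)
¬∀⇒∃¬ E P? ¬∀ with ∃? E (∁? P?)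
... | yes w = w
... | no ¬∃ = contradiction (λ x → decidable-stable (P? x) (λ ¬px → ¬∃ (x , ¬px))) ¬∀

enumerate-× : Enumeration X → Enumeration Y → Enumeration (X × Y)
enumerate-× EX EY = record
  { elements = List.cartesianProduct (elements EX) (elements EY)
  ; complete = λ (x , y) → ∈ₚ.∈-cartesianProduct⁺ (complete EX x) (complete EY y)
  }

enumerate-Vec : Enumeration X → ∀ n → Enumeration (Vec X n)
enumerate-Vec E n = record
  { elements = vectors (elements E) n
  ; complete = λ v → ∈-vectors⁺ (elements E) v (λ i → complete E (lookup v i))
  }

Least : (ℕ → Set) → Set
Least P = Σ ℕ λ d → P d × (∀ k → k < d → ¬ P k)

least : {P : ℕ → Set} → Decidable P → ∀ K → P K → Least P
least {P} P? = <-rec (λ K → P K → Least P) step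
  where
  step : ∀ K → (∀ {k} → k < K → P k → Least P) → P K → Least P
  step K smaller pK with ℕₚ.anyUpTo? P? K
  ... | yes (k , k<K , pk) = smaller k<K pk
  ... | no none = K , pK , λ k k<K pk → none (k , k<K , pk)

toℕ-punchIn-< : ∀ {k} (p : Fin (suc k)) (j : Fin k) → toℕ j < toℕ p → toℕ (punchIn p j) ≡ toℕ j
toℕ-punchIn-< (Fin.suc p) Fin.zero _ = refl
toℕ-punchIn-< (Fin.suc p) (Fin.suc j) j<p = cong suc (toℕ-punchIn-< p j (ℕₚ.≤-pred j<p))

toℕ≤toℕ-punchIn : ∀ {k} (p : Fin (suc k)) (j : Fin k) → toℕ j ≤ toℕ (punchIn p j)
toℕ≤toℕ-punchIn Fin.zero j = ℕₚ.n≤1+n _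
toℕ≤toℕ-punchIn (Fin.suc p) Fin.zero = z≤n
toℕ≤toℕ-punchIn (Fin.suc p) (Fin.suc j) = s≤s (toℕ≤toℕ-punchIn p j)

module Linear (F : FiniteField) where
  open FiniteField F renaming (Carrier to C)

  commutativeRing : CommutativeRing 0ℓ 0ℓ
  commutativeRing = record { isCommutativeRing = isCommutativeRing }

  open CommutativeRing commutativeRing
    using (_-_; +-identityˡ; +-identityʳ; +-assoc; -‿inverseʳ; *-identityʳ; *-assoc; *-comm; zeroʳ; distribˡ;
           ring; semiring; *-commutativeSemigroup)
  open import Algebra.Properties.CommutativeSemigroup *-commutativeSemigroup using (x∙yz≈y∙xz)
  open import Algebra.Properties.Ring ring
    using (-1*x≈-x; x[y-z]≈xy-xz; -0#≈0#; +-cancelʳ; x∙y⁻¹≈ε⇒x≈y; ⁻¹-anti-homo‿-; xyx⁻¹≈y)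
  open import Algebra.Properties.Semiring.Sum semiring
    using (sum; sum-cong-≗; sum-replicate-zero; ∑-distrib-+; ∑-comm; sum-remove; *-distribˡ-sum; *-distribʳ-sum)

  infix 4 _≟_ _≟ᵥ_
  _≟_ : (x y : C) → Dec (x ≡ y)
  _≟_ = Finₚ.inj⇒≟ (↔⇒↣ (↔-sym enumeration))

  elementsOf : Enumeration C
  elementsOf = record
    { elements = List.map to (List.allFin size)
    ; complete = λ x → subst (_∈ _) (inverseˡ refl) (∈ₚ.∈-map⁺ to (∈ₚ.∈-allFin (from x)))
    }
    where open Inverse enumeration

  elements-unique : Unique (elements elementsOf)
  elements-unique = Uniqueₚ.map⁺ (Injection.injective (↔⇒↣ enumeration)) (Uniqueₚ.allFin⁺ size)

  vectorsOf : ∀ n → Enumeration (Vec C n)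
  vectorsOf = enumerate-Vec elementsOf

  _≟ᵥ_ : ∀ {n} (x y : Vec C n) → Dec (x ≡ y)
  _≟ᵥ_ = Vecₚ.≡-dec _≟_

  ∑≡sum : ∀ {k} (f : Fin k → C) → ∑ F f ≡ sum f
  ∑≡sum {zero} f = refl
  ∑≡sum {suc k} f = cong (f Fin.zero +_) (∑≡sum (λ i → f (Fin.suc i)))

  x-[x-y]≡y : ∀ x y → x - (x - y) ≡ y
  x-[x-y]≡y x y = begin
    x - (x - y)     ≡⟨ cong (x +_) (⁻¹-anti-homo‿- x y) ⟩
    x + (y - x)     ≡⟨ +-assoc x y (- x) ⟨
    x + y - x       ≡⟨ xyx⁻¹≈y x y ⟩
    y               ∎
    where open ≡-Reasoning

  x-0≡x : ∀ x → x - 0# ≡ x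
  x-0≡x x = trans (cong (x +_) -0#≈0#) (+-identityʳ x)

  infix 7 _·_
  _·_ : ∀ {k} → (Fin k → C) → (Fin k → C) → C
  a · x = sum (λ j → a j * x j)

  sum-neg : ∀ {k} (f : Fin k → C) → - sum f ≡ sum (λ j → - f j)
  sum-neg f = begin
    - sum f                    ≡⟨ -1*x≈-x (sum f) ⟨
    - 1# * sum f               ≡⟨ *-distribˡ-sum (- 1#) f ⟩
    sum (λ j → - 1# * f j)     ≡⟨ sum-cong-≗ (λ j → -1*x≈-x (f j)) ⟩
    sum (λ j → - f j)          ∎
    where open ≡-Reasoning

  ·-congʳ : ∀ {k} (a : Fin k → C) {x y : Fin k → C} → (∀ j → x j ≡ y j) → a · x ≡ a · y
  ·-congʳ a x≗y = sum-cong-≗ (λ j → cong (a j *_) (x≗y j))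

  ·-comm : ∀ {k} (a x : Fin k → C) → a · x ≡ x · a
  ·-comm a x = sum-cong-≗ (λ j → *-comm (a j) (x j))

  ·-zeroʳ : ∀ {k} (a : Fin k → C) → a · (λ _ → 0#) ≡ 0#
  ·-zeroʳ {k} a = trans (sum-cong-≗ (λ j → zeroʳ (a j))) (sum-replicate-zero k)

  a·[x-y]≡a·x-a·y : ∀ {k} (a x y : Fin k → C) → a · (λ j → x j - y j) ≡ a · x - a · y
  a·[x-y]≡a·x-a·y a x y = begin
    a · (λ j → x j - y j)                         ≡⟨ sum-cong-≗ (λ j → x[y-z]≈xy-xz (a j) (x j) (y j)) ⟩
    sum (λ j → a j * x j - a j * y j)             ≡⟨ ∑-distrib-+ (λ j → a j * x j) (λ j → - (a j * y j)) ⟩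
    a · x + sum (λ j → - (a j * y j))             ≡⟨ cong (a · x +_) (sum-neg (λ j → a j * y j)) ⟨
    a · x - a · y                                 ∎
    where open ≡-Reasoning

  a·[cx]≡c[a·x] : ∀ {k} (a x : Fin k → C) c → a · (λ j → c * x j) ≡ c * (a · x)
  a·[cx]≡c[a·x] a x c = begin
    a · (λ j → c * x j)          ≡⟨ sum-cong-≗ (λ j → x∙yz≈y∙xz (a j) c (x j)) ⟩
    sum (λ j → c * (a j * x j))  ≡⟨ *-distribˡ-sum c (λ j → a j * x j) ⟨
    c * (a · x)                  ∎
    where open ≡-Reasoning

  indicator : ℕ → ℕ → C
  indicator a b = if a ℕ.≡ᵇ b then 1# else 0#

  indicator-refl : ∀ a → indicator a a ≡ 1#
  indicator-refl zero = refl
  indicator-refl (suc a) = indicator-refl a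

  indicator-≢ : ∀ {a b} → a ≢ b → indicator a b ≡ 0#
  indicator-≢ {zero} {zero} a≢b = contradiction refl a≢b
  indicator-≢ {zero} {suc b} _ = refl
  indicator-≢ {suc a} {zero} _ = refl
  indicator-≢ {suc a} {suc b} a≢b = indicator-≢ (a≢b ∘ cong suc)

  indicator-sym : ∀ a b → indicator a b ≡ indicator b a
  indicator-sym a b with a ℕ.≟ b
  ... | yes refl = refl
  ... | no a≢b = trans (indicator-≢ a≢b) (sym (indicator-≢ (a≢b ∘ sym)))

  δ : ∀ {k} → Fin k → Fin k → C
  δ p j = indicator (toℕ p) (toℕ j)

  ·-δ : ∀ {k} (a : Fin k → C) (p : Fin k) → a · δ p ≡ a p
  ·-δ {suc k} a p = begin
    a · δ p                                              ≡⟨ sum-remove {i = p} (λ j → a j * δ p j) ⟩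
    a p * δ p p + sum (λ j → a (punchIn p j) * δ p (punchIn p j))
      ≡⟨ cong₂ _+_ (trans (cong (a p *_) (indicator-refl (toℕ p))) (*-identityʳ (a p)))
                   (trans (sum-cong-≗ off-diagonal) (sum-replicate-zero k)) ⟩
    a p + 0#                                             ≡⟨ +-identityʳ (a p) ⟩
    a p                                                  ∎
    where
    open ≡-Reasoning
    off-diagonal : ∀ j → a (punchIn p j) * δ p (punchIn p j) ≡ 0#
    off-diagonal j = trans (cong (a (punchIn p j) *_)
                             (indicator-≢ (λ e → Finₚ.punchInᵢ≢i p j (Finₚ.toℕ-injective (sym e)))))
                           (zeroʳ _)

  ·-removeAt : ∀ {k} (a x : Fin (suc k) → C) p → a · x ≡ a p * x p + (a ∘ punchIn p) · (x ∘ punchIn p)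
  ·-removeAt a x p = sum-remove {i = p} (λ j → a j * x j)

  lookup-unit : ∀ n j (i : Fin n) → lookup (unit F n j) i ≡ indicator j (suc (toℕ i))
  lookup-unit n j i = Vecₚ.lookup∘tabulate _ i

  lookup-unit-≥ : ∀ n j (i : Fin n) → j ≤ toℕ i → lookup (unit F n j) i ≡ 0#
  lookup-unit-≥ n j i j≤i = trans (lookup-unit n j i) (indicator-≢ (ℕₚ.<⇒≢ (s≤s j≤i)))

  lookup-unit-toℕ : ∀ {n n′} j (i : Fin n) (i′ : Fin n′) → toℕ i ≡ toℕ i′ →
    lookup (unit F n j) i ≡ lookup (unit F n′ j) i′
  lookup-unit-toℕ {n} {n′} j i i′ e =
    trans (lookup-unit n j i) (trans (cong (λ a → indicator j (suc a)) e) (sym (lookup-unit n′ j i′)))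

  -- Affine maps

  module _ {k n : ℕ} (φ : Affine F k n) where
    open Affine φ

    lookup-apply : ∀ x i → lookup (apply F φ x) i ≡ M i · lookup x + b i
    lookup-apply x i = trans (Vecₚ.lookup∘tabulate _ i) (cong (_+ b i) (∑≡sum (λ j → M i j * lookup x j)))

    apply-≡⇒kernel : ∀ {x y} → apply F φ x ≡ apply F φ y → ∀ i → M i · (λ j → lookup x j - lookup y j) ≡ 0#
    apply-≡⇒kernel {x} {y} φx≡φy i = begin
      M i · (λ j → lookup x j - lookup y j)    ≡⟨ a·[x-y]≡a·x-a·y (M i) (lookup x) (lookup y) ⟩
      M i · lookup x - M i · lookup y          ≡⟨ cong (_- M i · lookup y) Mx≡My ⟩
      M i · lookup y - M i · lookup y          ≡⟨ -‿inverseʳ (M i · lookup y) ⟩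
      0#                                       ∎
      where
      open ≡-Reasoning
      Mx≡My : M i · lookup x ≡ M i · lookup y
      Mx≡My = +-cancelʳ (b i) _ _
        (trans (sym (lookup-apply x i)) (trans (cong (λ z → lookup z i) φx≡φy) (lookup-apply y i)))

    apply-shift : ∀ {v} → (∀ i → M i · v ≡ 0#) → ∀ x c →
      apply F φ (tabulate (λ j → lookup x j - c * v j)) ≡ apply F φ x
    apply-shift {v} Mv≡0 x c = lookup-ext λ i → begin
      lookup (apply F φ x′) i                  ≡⟨ lookup-apply x′ i ⟩
      M i · lookup x′ + b i                    ≡⟨ cong (_+ b i) (·-congʳ (M i) (Vecₚ.lookup∘tabulate _)) ⟩
      M i · (λ j → lookup x j - c * v j) + b i  ≡⟨ cong (_+ b i) (a·[x-y]≡a·x-a·y (M i) (lookup x) (λ j → c * v j)) ⟩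
      M i · lookup x - M i · (λ j → c * v j) + b i
        ≡⟨ cong (λ z → M i · lookup x - z + b i)
                (trans (a·[cx]≡c[a·x] (M i) v c) (trans (cong (c *_) (Mv≡0 i)) (zeroʳ c))) ⟩
      M i · lookup x - 0# + b i                ≡⟨ cong (λ z → M i · lookup x + z + b i) -0#≈0# ⟩
      M i · lookup x + 0# + b i                ≡⟨ cong (_+ b i) (+-identityʳ _) ⟩
      M i · lookup x + b i                     ≡⟨ lookup-apply x i ⟨
      lookup (apply F φ x) i                   ∎
      where
      open ≡-Reasoning
      x′ = tabulate (λ j → lookup x j - c * v j)

  dropColumn : ∀ {k n} → Fin (suc k) → Affine F (suc k) n → Affine F k n
  dropColumn p φ = record { M = λ i j → Affine.M φ i (punchIn p j) ; b = Affine.b φ }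

  apply-dropColumn : ∀ {k n} (p : Fin (suc k)) (φ : Affine F (suc k) n) z → lookup z p ≡ 0# →
    apply F φ z ≡ apply F (dropColumn p φ) (tabulate (lookup z ∘ punchIn p))
  apply-dropColumn p φ z zp≡0 = lookup-ext λ i → begin
    lookup (apply F φ z) i                                 ≡⟨ lookup-apply φ z i ⟩
    M i · lookup z + b i                                   ≡⟨ cong (_+ b i) (·-removeAt (M i) (lookup z) p) ⟩
    M i p * lookup z p + (M i ∘ punchIn p) · (lookup z ∘ punchIn p) + b i
      ≡⟨ cong (λ w → M i p * w + (M i ∘ punchIn p) · (lookup z ∘ punchIn p) + b i) zp≡0 ⟩
    M i p * 0# + (M i ∘ punchIn p) · (lookup z ∘ punchIn p) + b i
      ≡⟨ cong (λ w → w + (M i ∘ punchIn p) · (lookup z ∘ punchIn p) + b i) (zeroʳ (M i p)) ⟩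
    0# + (M i ∘ punchIn p) · (lookup z ∘ punchIn p) + b i
      ≡⟨ cong (_+ b i) (trans (+-identityˡ _) (·-congʳ (M i ∘ punchIn p) (λ j → sym (Vecₚ.lookup∘tabulate _ j)))) ⟩
    (M i ∘ punchIn p) · lookup z′ + b i                    ≡⟨ lookup-apply (dropColumn p φ) z′ i ⟨
    lookup (apply F (dropColumn p φ) z′) i                 ∎
    where
    open ≡-Reasoning
    open Affine φ
    z′ = tabulate (lookup z ∘ punchIn p)

  module _ {k n T : ℕ} (φ : Affine F k n) (fixed : TFixed F (ℤ.+ T) φ) where
    open Affine φ

    fixed-offset : ∀ i → b i ≡ 0#
    fixed-offset i = begin
      b i                                   ≡⟨ +-identityˡ (b i) ⟨
      0# + b i                              ≡⟨ cong (_+ b i) (trans (·-congʳ (M i) (lookup-unit k 0)) (·-zeroʳ (M i))) ⟨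
      M i · lookup (unit F k 0) + b i       ≡⟨ lookup-apply φ (unit F k 0) i ⟨
      lookup (apply F φ (unit F k 0)) i     ≡⟨ cong (λ z → lookup z i) (fixed 0 (ℤ.+≤+ z≤n)) ⟩
      lookup (unit F n 0) i                 ≡⟨ lookup-unit n 0 i ⟩
      0#                                    ∎
      where open ≡-Reasoning

    fixed-column : ∀ i j → toℕ j < T → M i j ≡ indicator (toℕ i) (toℕ j)
    fixed-column i j j<T = begin
      M i j                                         ≡⟨ +-identityʳ (M i j) ⟨
      M i j + 0#                                    ≡⟨ cong₂ _+_ (·-δ (M i) j) (fixed-offset i) ⟨
      M i · δ j + b i                               ≡⟨ cong (_+ b i) (·-congʳ (M i) (lookup-unit k (suc (toℕ j)))) ⟨
      M i · lookup (unit F k (suc (toℕ j))) + b i   ≡⟨ lookup-apply φ (unit F k (suc (toℕ j))) i ⟨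
      lookup (apply F φ (unit F k (suc (toℕ j)))) i ≡⟨ cong (λ z → lookup z i) (fixed (suc (toℕ j)) (ℤ.+≤+ j<T)) ⟩
      lookup (unit F n (suc (toℕ j))) i             ≡⟨ lookup-unit n (suc (toℕ j)) i ⟩
      indicator (toℕ j) (toℕ i)                     ≡⟨ indicator-sym (toℕ j) (toℕ i) ⟩
      indicator (toℕ i) (toℕ j)                     ∎
      where open ≡-Reasoning

  +≤⇒≤⁺ : ∀ t j → ℤ.+ j ℤ.≤ t → j ≤ _⁺ F t
  +≤⇒≤⁺ (ℤ.+ T) j (ℤ.+≤+ j≤T) = j≤T

  -- The fixed columns of a t-fixed map are unit vectors, so they cannot support a kernel vector.
  fixed-kernel-vanishes : ∀ {k n} t (φ : Affine F k n) → TFixed F t φ → _⁺ F t ≤ n →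
    ∀ {v} → (∀ i → Affine.M φ i · v ≡ 0#) → (∀ l → _⁺ F t ≤ toℕ l → v l ≡ 0#) → ∀ q → v q ≡ 0#
  fixed-kernel-vanishes -[1+ _ ] φ _ _ _ vanishes q = vanishes q z≤n
  fixed-kernel-vanishes (ℤ.+ T) φ fixed T≤n {v} Mv≡0 vanishes q with T ≤? toℕ q
  ... | yes T≤q = vanishes q T≤q
  ... | no T≰q = begin
    v q          ≡⟨ ·-δ v q ⟨
    v · δ q      ≡⟨ ·-comm v (δ q) ⟩
    δ q · v      ≡⟨ sum-cong-≗ row-i ⟩
    M i · v      ≡⟨ Mv≡0 i ⟩
    0#           ∎
    where
    open ≡-Reasoning
    open Affine φ
    q<n : toℕ q < _
    q<n = ℕₚ.<-≤-trans (ℕₚ.≰⇒> T≰q) T≤n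
    i = Fin.fromℕ< q<n
    row-i : ∀ l → δ q l * v l ≡ M i l * v l
    row-i l with toℕ l <? T
    ... | yes l<T = cong (_* v l) (sym (trans (fixed-column φ fixed i l l<T)
                                             (cong (λ a → indicator a (toℕ l)) (Finₚ.toℕ-fromℕ< q<n))))
    ... | no l≮T = trans (cong (δ q l *_) vl≡0) (trans (zeroʳ _) (sym (trans (cong (M i l *_) vl≡0) (zeroʳ _))))
      where vl≡0 = vanishes l (ℕₚ.≮⇒≥ l≮T)

  Covers : ∀ {k n m} → Affine F k n → Vec (Vecs F n) m → Set
  Covers {k} φ s = ∀ j → Σ (Vecs F k) λ x → apply F φ x ≡ lookup s j

  dropColumn-fixed : ∀ {k n} t (p : Fin (suc k)) (φ : Affine F (suc k) n) → _⁺ F t ≤ toℕ p →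
    TFixed F t φ → TFixed F t (dropColumn p φ)
  dropColumn-fixed {k} {n} t p φ t⁺≤p fixed j j≤t = begin
    apply F (dropColumn p φ) (unit F k j)
      ≡⟨ cong (apply F (dropColumn p φ)) removed-unit ⟨
    apply F (dropColumn p φ) (tabulate (lookup (unit F (suc k) j) ∘ punchIn p))
      ≡⟨ apply-dropColumn p φ (unit F (suc k) j) (lookup-unit-≥ _ j p j≤p) ⟨
    apply F φ (unit F (suc k) j)
      ≡⟨ fixed j j≤t ⟩
    unit F n j
      ∎
    where
    open ≡-Reasoning
    j≤p : j ≤ toℕ p
    j≤p = ℕₚ.≤-trans (+≤⇒≤⁺ t j j≤t) t⁺≤p
    unit-punchIn : ∀ l → lookup (unit F (suc k) j) (punchIn p l) ≡ lookup (unit F k j) l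
    unit-punchIn l with toℕ l <? toℕ p
    ... | yes l<p = lookup-unit-toℕ j (punchIn p l) l (toℕ-punchIn-< p l l<p)
    ... | no l≮p = trans (lookup-unit-≥ (suc k) j (punchIn p l) (ℕₚ.≤-trans j≤l (toℕ≤toℕ-punchIn p l)))
                         (sym (lookup-unit-≥ k j l j≤l))
      where j≤l = ℕₚ.≤-trans j≤p (ℕₚ.≮⇒≥ l≮p)
    removed-unit : tabulate (lookup (unit F (suc k) j) ∘ punchIn p) ≡ unit F k j
    removed-unit = lookup-ext λ l → trans (Vecₚ.lookup∘tabulate _ l) (unit-punchIn l)

  -- Translating along the kernel vector v makes coordinate p of every preimage vanish.
  dropColumn-covers : ∀ {k n m} (p : Fin (suc k)) (φ : Affine F (suc k) n) (s : Vec (Vecs F n) m) {v} →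
    (∀ i → Affine.M φ i · v ≡ 0#) → v p ≢ 0# → Covers φ s → Covers (dropColumn p φ) s
  dropColumn-covers p φ s {v} Mv≡0 vp≢0 covers j = tabulate (lookup x′ ∘ punchIn p) , (begin
    apply F (dropColumn p φ) (tabulate (lookup x′ ∘ punchIn p))   ≡⟨ apply-dropColumn p φ x′ x′p≡0 ⟨
    apply F φ x′                                                  ≡⟨ apply-shift φ {v} Mv≡0 x c ⟩
    apply F φ x                                                   ≡⟨ proj₂ (covers j) ⟩
    lookup s j                                                    ∎)
    where
    open ≡-Reasoning
    x = proj₁ (covers j)
    w = proj₁ (inverse (v p) vp≢0)
    c = lookup x p * w
    x′ = tabulate (λ l → lookup x l - c * v l)
    cvp≡xp : c * v p ≡ lookup x p
    cvp≡xp = begin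
      lookup x p * w * v p        ≡⟨ *-assoc (lookup x p) w (v p) ⟩
      lookup x p * (w * v p)      ≡⟨ cong (lookup x p *_) (trans (*-comm w (v p)) (proj₂ (inverse (v p) vp≢0))) ⟩
      lookup x p * 1#             ≡⟨ *-identityʳ (lookup x p) ⟩
      lookup x p                  ∎
    x′p≡0 : lookup x′ p ≡ 0#
    x′p≡0 = trans (Vecₚ.lookup∘tabulate (λ l → lookup x l - c * v l) p)
                  (trans (cong (λ z → lookup x p - z) cvp≡xp) (-‿inverseʳ (lookup x p)))

  -- Fits and dimension

  Fitting : ∀ {k n m} → ℤ → Vec (Vecs F n) m → Affine F k n → Set
  Fitting t s φ = InjectiveAff F φ × TFixed F t φ × Covers φ s

  Fitting-resp : ∀ {k n m} t (s : Vec (Vecs F n) m) {φ ψ : Affine F k n} →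
    (∀ x → apply F φ x ≡ apply F ψ x) → Fitting t s φ → Fitting t s ψ
  Fitting-resp {k} {n} t s φ≗ψ (injective , fixed , covers) =
    (λ x y ψx≡ψy → injective x y (trans (φ≗ψ x) (trans ψx≡ψy (sym (φ≗ψ y))))) ,
    (λ j j≤t → trans (sym (φ≗ψ (unit F k j))) (fixed j j≤t)) ,
    (λ j → proj₁ (covers j) , trans (sym (φ≗ψ (proj₁ (covers j)))) (proj₂ (covers j)))

  -- Affine maps have function fields, so they are enumerated through their tables of entries.
  fromEntries : ∀ {k n} → Vec (Vec C k) n × Vec C n → Affine F k n
  fromEntries (M , b) = record { M = λ i j → lookup (lookup M i) j ; b = lookup b }

  entries : ∀ {k n} → Affine F k n → Vec (Vec C k) n × Vec C n
  entries φ = tabulate (λ i → tabulate (Affine.M φ i)) , tabulate (Affine.b φ)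

  apply-fromEntries-entries : ∀ {k n} (φ : Affine F k n) x → apply F (fromEntries (entries φ)) x ≡ apply F φ x
  apply-fromEntries-entries φ x = lookup-ext λ i →
    trans (lookup-apply (fromEntries (entries φ)) x i)
      (trans (cong₂ _+_ (sum-cong-≗ λ j → cong (_* lookup x j) (entry i j)) (Vecₚ.lookup∘tabulate _ i))
             (sym (lookup-apply φ x i)))
    where
    entry : ∀ i j → lookup (lookup (tabulate (λ i → tabulate (Affine.M φ i))) i) j ≡ Affine.M φ i j
    entry i j = trans (cong (λ row → lookup row j) (Vecₚ.lookup∘tabulate _ i)) (Vecₚ.lookup∘tabulate _ j)

  identifies? : ∀ {k n} (φ : Affine F k n) x y → Dec (apply F φ x ≡ apply F φ y → x ≡ y)
  identifies? φ x y = (apply F φ x ≟ᵥ apply F φ y) →-dec (x ≟ᵥ y)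

  injective? : ∀ {k n} (φ : Affine F k n) → Dec (InjectiveAff F φ)
  injective? {k} φ = ∀? (vectorsOf k) λ x → ∀? (vectorsOf k) (identifies? φ x)

  fixed? : ∀ {k n} t (φ : Affine F k n) → Dec (TFixed F t φ)
  fixed? {k} {n} (ℤ.+ T) φ with ℕₚ.allUpTo? (λ j → apply F φ (unit F k j) ≟ᵥ unit F n j) (suc T)
  ... | yes fixed = yes λ j j≤T → fixed (s≤s (ℤ.drop‿+≤+ j≤T))
  ... | no ¬fixed = no λ fixed → ¬fixed λ j<1+T → fixed _ (ℤ.+≤+ (ℕₚ.≤-pred j<1+T))
  fixed? -[1+ _ ] φ = yes λ j ()

  covers? : ∀ {k n m} (φ : Affine F k n) (s : Vec (Vecs F n) m) → Dec (Covers φ s)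
  covers? {k} φ s = Finₚ.all? λ j → ∃? (vectorsOf k) (λ x → apply F φ x ≟ᵥ lookup s j)

  fits? : ∀ {n m} t (s : Vec (Vecs F n) m) k → Dec (Fits F t s k)
  fits? {n} t s k with _⁺ F t ≤? k | ∃? (enumerate-× (enumerate-Vec (vectorsOf k) n) (vectorsOf n)) fitting?
    where
    fitting? : ∀ e → Dec (Fitting t s (fromEntries e))
    fitting? e = injective? (fromEntries e) ×-dec fixed? t (fromEntries e) ×-dec covers? (fromEntries e) s
  ... | no t⁺≰k | _ = no (t⁺≰k ∘ proj₁)
  ... | yes t⁺≤k | yes (e , fitting) = yes (t⁺≤k , fromEntries e , fitting)
  ... | yes _ | no ¬fitting = no λ (_ , φ , fitting) →
    ¬fitting (entries φ , Fitting-resp t s (λ x → sym (apply-fromEntries-entries φ x)) fitting)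

  identity : ∀ n → Affine F n n
  identity n = record { M = δ ; b = λ _ → 0# }

  apply-identity : ∀ {n} (x : Vec C n) → apply F (identity n) x ≡ x
  apply-identity x = lookup-ext λ i →
    trans (lookup-apply (identity _) x i)
      (trans (+-identityʳ _) (trans (·-comm (δ i) (lookup x)) (·-δ (lookup x) i)))

  fits-identity : ∀ {n m} t (s : Vec (Vecs F n) m) → _⁺ F t ≤ n → Fits F t s n
  fits-identity t s t⁺≤n = t⁺≤n , identity _ ,
    (λ x y e → trans (sym (apply-identity x)) (trans e (apply-identity y))) ,
    (λ j _ → apply-identity _) ,
    (λ j → lookup s j , apply-identity _)

  dimension : ∀ {n m} t (s : Vec (Vecs F n) m) → _⁺ F t ≤ n → Σ ℕ (IsDim F t s)
  dimension {n} t s t⁺≤n = least (fits? t s) n (fits-identity t s t⁺≤n)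

  collision : ∀ {k n} (φ : Affine F k n) → ¬ InjectiveAff F φ →
    Σ (Vecs F k) λ x → Σ (Vecs F k) λ y → apply F φ x ≡ apply F φ y × x ≢ y
  collision {k} φ ¬injective
    with x , ¬injective-at-x ← ¬∀⇒∃¬ (vectorsOf k) (λ x → ∀? (vectorsOf k) (identifies? φ x)) ¬injective
    with y , ¬identifies ← ¬∀⇒∃¬ (vectorsOf k) (identifies? φ x) ¬injective-at-x
    = x , y ,
      decidable-stable (apply F φ x ≟ᵥ apply F φ y) (λ φx≢φy → ¬identifies (λ φx≡φy → contradiction φx≡φy φx≢φy)) ,
      (λ x≡y → ¬identifies (λ _ → x≡y))

  noninjective⇒kernel-vector : ∀ {k n} t (φ : Affine F k n) → TFixed F t φ → _⁺ F t ≤ n → ¬ InjectiveAff F φ →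
    Σ (Fin k) λ p → _⁺ F t ≤ toℕ p × Σ (Fin k → C) λ v → (∀ i → Affine.M φ i · v ≡ 0#) × v p ≢ 0#
  noninjective⇒kernel-vector t φ fixed t⁺≤n ¬injective
    with x , y , φx≡φy , x≢y ← collision φ ¬injective
    with Finₚ.any? (λ p → (_⁺ F t ≤? toℕ p) ×-dec ¬? (lookup x p - lookup y p ≟ 0#))
  ... | yes (p , t⁺≤p , vp≢0) = p , t⁺≤p , _ , apply-≡⇒kernel φ {x} {y} φx≡φy , vp≢0
  ... | no none = contradiction (lookup-ext λ q → x∙y⁻¹≈ε⇒x≈y _ _ (v≡0 q)) x≢y
    where
    v≡0 = fixed-kernel-vanishes t φ fixed t⁺≤n (apply-≡⇒kernel φ {x} {y} φx≡φy)
            (λ l t⁺≤l → decidable-stable (_ ≟ 0#) (λ vl≢0 → none (l , t⁺≤l , vl≢0)))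

  shrink : ∀ {n m} t (s : Vec (Vecs F n) m) → _⁺ F t ≤ n → ∀ {k} → _⁺ F t ≤ k → (φ : Affine F k n) →
    TFixed F t φ → Covers φ s → Σ ℕ λ k′ → k′ ≤ k × Fits F t s k′
  shrink t s t⁺≤n {k} t⁺≤k φ fixed covers with injective? φ
  ... | yes injective = k , ℕₚ.≤-refl , t⁺≤k , φ , injective , fixed , covers
  ... | no ¬injective with noninjective⇒kernel-vector t φ fixed t⁺≤n ¬injective
  shrink t s t⁺≤n {suc k} t⁺≤k φ fixed covers | no _ | p , t⁺≤p , v , kernel , vp≢0
    with k′ , k′≤k , fits ← shrink t s t⁺≤n (ℕₚ.≤-trans t⁺≤p (ℕₚ.≤-pred (Finₚ.toℕ<n p))) (dropColumn p φ)
                              (dropColumn-fixed t p φ t⁺≤p fixed) (dropColumn-covers p φ s {v} kernel vp≢0 covers)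
    = k′ , ℕₚ.m≤n⇒m≤1+n k′≤k , fits

  compose : ∀ {k n n₀} → (Fin n₀ → Fin n → C) → Affine F k n → Affine F k n₀
  compose P φ = record { M = λ i j → P i · (λ c → Affine.M φ c j) ; b = λ i → P i · Affine.b φ }

  lookup-apply-compose : ∀ {k n n₀} (P : Fin n₀ → Fin n → C) (φ : Affine F k n) x i →
    lookup (apply F (compose P φ) x) i ≡ P i · lookup (apply F φ x)
  lookup-apply-compose P φ x i = begin
    lookup (apply F (compose P φ) x) i
      ≡⟨ lookup-apply (compose P φ) x i ⟩
    sum (λ j → sum (λ c → P i c * M c j) * lookup x j) + P i · b
      ≡⟨ cong (_+ P i · b) (sum-cong-≗ λ j → trans (*-distribʳ-sum (lookup x j) (λ c → P i c * M c j))
                                                  (sum-cong-≗ λ c → *-assoc (P i c) (M c j) (lookup x j))) ⟩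
    sum (λ j → sum (λ c → P i c * (M c j * lookup x j))) + P i · b
      ≡⟨ cong (_+ P i · b) (∑-comm (λ j c → P i c * (M c j * lookup x j))) ⟩
    sum (λ c → sum (λ j → P i c * (M c j * lookup x j))) + P i · b
      ≡⟨ cong (_+ P i · b) (sum-cong-≗ λ c → *-distribˡ-sum (P i c) (λ j → M c j * lookup x j)) ⟨
    sum (λ c → P i c * (M c · lookup x)) + P i · b
      ≡⟨ ∑-distrib-+ (λ c → P i c * (M c · lookup x)) (λ c → P i c * b c) ⟨
    sum (λ c → P i c * (M c · lookup x) + P i c * b c)
      ≡⟨ sum-cong-≗ (λ c → trans (sym (distribˡ (P i c) _ _)) (cong (P i c *_) (sym (lookup-apply φ x c)))) ⟩
    P i · lookup (apply F φ x)
      ∎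
    where
    open ≡-Reasoning
    open Affine φ

  apply-compose : ∀ {k n n₀} (P : Fin n₀ → Fin n → C) (φ : Affine F k n) {x y y₀} →
    apply F φ x ≡ y → (∀ i → P i · lookup y ≡ lookup y₀ i) → apply F (compose P φ) x ≡ y₀
  apply-compose P φ {x} refl Py≡y₀ = lookup-ext λ i → trans (lookup-apply-compose P φ x i) (Py≡y₀ i)

  fits-compose : ∀ {k n n₀ m} t (P : Fin n₀ → Fin n → C) {s : Vec (Vecs F n) m} {s₀ : Vec (Vecs F n₀) m} →
    (∀ j i → P i · lookup (lookup s j) ≡ lookup (lookup s₀ j) i) →
    (∀ j → ℤ.+ j ℤ.≤ t → ∀ i → P i · lookup (unit F n j) ≡ lookup (unit F n₀ j) i) →
    _⁺ F t ≤ n₀ → Fits F t s k → Σ ℕ λ k′ → k′ ≤ k × Fits F t s₀ k′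
  fits-compose {k} t P {s₀ = s₀} Ps≡s₀ Pe≡e t⁺≤n₀ (t⁺≤k , φ , _ , fixed , covers) =
    shrink t s₀ t⁺≤n₀ t⁺≤k (compose P φ)
      (λ j j≤t → apply-compose P φ {unit F k j} (fixed j j≤t) (Pe≡e j j≤t))
      (λ j → proj₁ (covers j) , apply-compose P φ {proj₁ (covers j)} (proj₂ (covers j)) (Ps≡s₀ j))

  δ-· : ∀ {k} (p : Fin k) (a : Fin k → C) → δ p · a ≡ a p
  δ-· p a = trans (·-comm (δ p) a) (·-δ a p)

  δ-δ-· : ∀ {k} (p q : Fin k) (a : Fin k → C) → (λ c → δ p c - δ q c) · a ≡ a p - a q
  δ-δ-· p q a = begin
    (λ c → δ p c - δ q c) · a     ≡⟨ ·-comm (λ c → δ p c - δ q c) a ⟩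
    a · (λ c → δ p c - δ q c)     ≡⟨ a·[x-y]≡a·x-a·y a (δ p) (δ q) ⟩
    a · δ p - a · δ q             ≡⟨ cong₂ _-_ (·-δ a p) (·-δ a q) ⟩
    a p - a q                     ∎
    where open ≡-Reasoning

  -- Kernel and saturated solutions

  column : ∀ {n m} → Fin n → Vec (Vecs F n) m → Vec C m
  column c s = tabulate (λ j → lookup (lookup s j) c)

  lookup-column : ∀ {n m} (c : Fin n) (s : Vec (Vecs F n) m) j → lookup (column c s) j ≡ lookup (lookup s j) c
  lookup-column c s j = Vecₚ.lookup∘tabulate _ j

  module _ {r m : ℕ} (A : Fin r → Fin m → ℤ) where

    row : Fin r → Fin m → C
    row i j = fromℤ F (A i j)

    InKernel : Vec C m → Set
    InKernel v = ∀ i → row i · lookup v ≡ 0#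

    inKernel? : Decidable InKernel
    inKernel? v = Finₚ.all? (λ i → row i · lookup v ≟ 0#)

    InKernel-zero : InKernel (Vec.replicate m 0#)
    InKernel-zero i = trans (·-congʳ (row i) (λ j → Vecₚ.lookup-replicate j 0#)) (·-zeroʳ (row i))

    InKernel-difference : ∀ {u w} → InKernel u → InKernel w → InKernel (tabulate (λ j → lookup u j - lookup w j))
    InKernel-difference {u} {w} u∈K w∈K i = begin
      row i · lookup (tabulate (λ j → lookup u j - lookup w j))  ≡⟨ ·-congʳ (row i) (Vecₚ.lookup∘tabulate _) ⟩
      row i · (λ j → lookup u j - lookup w j)                    ≡⟨ a·[x-y]≡a·x-a·y (row i) (lookup u) (lookup w) ⟩
      row i · lookup u - row i · lookup w                        ≡⟨ cong₂ _-_ (u∈K i) (w∈K i) ⟩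
      0# - 0#                                                    ≡⟨ -‿inverseʳ 0# ⟩
      0#                                                         ∎
      where open ≡-Reasoning

    IsSolution⇒InKernel : ∀ {n} {s : Vec (Vecs F n) m} → IsSolution F A s → ∀ c → InKernel (column c s)
    IsSolution⇒InKernel {s = s} solution c i =
      trans (·-congʳ (row i) (lookup-column c s))
            (trans (sym (∑≡sum (λ j → fromℤ F (A i j) * lookup (lookup s j) c))) (solution i c))

    InKernel⇒IsSolution : ∀ {n} {s : Vec (Vecs F n) m} → (∀ c → InKernel (column c s)) → IsSolution F A s
    InKernel⇒IsSolution {s = s} columns∈K i c =
      trans (∑≡sum (λ j → fromℤ F (A i j) * lookup (lookup s j) c))
            (trans (·-congʳ (row i) (λ j → sym (lookup-column c s j))) (columns∈K c i))

    Saturated : ∀ {n} → ℤ → Vec (Vecs F n) m → Set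
    Saturated {n} t s = ∀ v → InKernel v → Σ (Fin n) λ c → _⁺ F t ≤ toℕ c × column c s ≡ v

    -- A saturated solution contains every kernel vector as a column beyond the fixed coordinates, so every
    -- solution is the image of it under a linear map fixing e₀, …, e_t: choose each row of the map to pick out
    -- the right column (corrected by a fixed coordinate for the first t⁺ rows).
    saturated⇒projection : ∀ {n n₀} t {s : Vec (Vecs F n) m} {s₀ : Vec (Vecs F n₀) m} →
      Saturated t s → IsSolution F A s → _⁺ F t ≤ n → IsSolution F A s₀ →
      Σ (Fin n₀ → Fin n → C) λ P → (∀ j i → P i · lookup (lookup s j) ≡ lookup (lookup s₀ j) i) ×
                                    (∀ j → ℤ.+ j ℤ.≤ t → ∀ i → P i · lookup (unit F n j) ≡ lookup (unit F n₀ j) i)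
    saturated⇒projection {n} {n₀} t {s} {s₀} saturated solution t⁺≤n solution₀ =
      (λ i → proj₁ (P-row i)) , (λ j i → proj₁ (proj₂ (P-row i)) j) , (λ j j≤t i → proj₂ (proj₂ (P-row i)) j j≤t)
      where
      RowSpec : Fin n₀ → (Fin n → C) → Set
      RowSpec i ρ = (∀ j → ρ · lookup (lookup s j) ≡ lookup (lookup s₀ j) i) ×
                    (∀ j → ℤ.+ j ℤ.≤ t → ρ · lookup (unit F n j) ≡ lookup (unit F n₀ j) i)

      column-of : ∀ v → InKernel v → Σ (Fin n) λ β → _⁺ F t ≤ toℕ β × (∀ j → lookup (lookup s j) β ≡ lookup v j)
      column-of v v∈K with β , t⁺≤β , sβ≡v ← saturated v v∈K =
        β , t⁺≤β , λ j → trans (sym (lookup-column β s j)) (cong (λ w → lookup w j) sβ≡v)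

      unit-beyond : ∀ {n′} (β : Fin n′) → _⁺ F t ≤ toℕ β → ∀ j → ℤ.+ j ℤ.≤ t → lookup (unit F n′ j) β ≡ 0#
      unit-beyond β t⁺≤β j j≤t = lookup-unit-≥ _ j β (ℕₚ.≤-trans (+≤⇒≤⁺ t j j≤t) t⁺≤β)

      P-row : ∀ i → Σ (Fin n → C) (RowSpec i)
      P-row i with toℕ i <? _⁺ F t
      ... | no i≮t⁺ =
        δ β ,
        (λ j → trans (δ-· β (lookup (lookup s j))) (trans (sβ≡v j) (lookup-column i s₀ j))) ,
        (λ j j≤t → trans (δ-· β (lookup (unit F n j)))
                     (trans (unit-beyond β t⁺≤β j j≤t) (sym (unit-beyond i (ℕₚ.≮⇒≥ i≮t⁺) j j≤t))))
        where
        β-spec = column-of (column i s₀) (IsSolution⇒InKernel {s = s₀} solution₀ i)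
        β = proj₁ β-spec
        t⁺≤β = proj₁ (proj₂ β-spec)
        sβ≡v = proj₂ (proj₂ β-spec)
      ... | yes i<t⁺ =
        (λ c → δ ι c - δ β c) ,
        (λ j → trans (δ-δ-· ι β (lookup (lookup s j)))
                 (trans (cong (λ z → lookup (lookup s j) ι - z) (sβ≡d j)) (x-[x-y]≡y _ _))) ,
        (λ j j≤t → trans (δ-δ-· ι β (lookup (unit F n j)))
                     (trans (cong₂ _-_ (lookup-unit-toℕ j ι i ι≡i) (unit-beyond β t⁺≤β j j≤t)) (x-0≡x _)))
        where
        i<n = ℕₚ.<-≤-trans i<t⁺ t⁺≤n
        ι = Fin.fromℕ< i<n
        ι≡i = Finₚ.toℕ-fromℕ< i<n
        β-spec = column-of (tabulate (λ j → lookup (column ι s) j - lookup (column i s₀) j))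
                   (InKernel-difference {column ι s} {column i s₀} (IsSolution⇒InKernel {s = s} solution ι)
                                                          (IsSolution⇒InKernel {s = s₀} solution₀ i))
        β = proj₁ β-spec
        t⁺≤β = proj₁ (proj₂ β-spec)
        sβ≡d : ∀ j → lookup (lookup s j) β ≡ lookup (lookup s j) ι - lookup (lookup s₀ j) i
        sβ≡d j = trans (proj₂ (proj₂ β-spec) j)
                   (trans (Vecₚ.lookup∘tabulate (λ j → lookup (column ι s) j - lookup (column i s₀) j) j)
                          (cong₂ _-_ (lookup-column ι s j) (lookup-column i s₀ j)))

    saturated-dim : ∀ {n n₀} t D {s : Vec (Vecs F n) m} {s₀ : Vec (Vecs F n₀) m} →
      Saturated t s → IsSolution F A s → _⁺ F t ≤ n → IsSolution F A s₀ → _⁺ F t ≤ n₀ → IsDim F t s₀ D →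
      (∀ d → IsDim F t s d → d ≤ D) → IsDim F t s D
    saturated-dim t D {s} {s₀} saturated solution t⁺≤n solution₀ t⁺≤n₀ (_ , D-least) dim≤D
      with d , dim-d ← dimension t s t⁺≤n
      with P , Ps≡s₀ , Pe≡e ← saturated⇒projection t {s = s} {s₀ = s₀} saturated solution t⁺≤n solution₀
      with k′ , k′≤d , fits-k′ ← fits-compose t P {s = s} {s₀ = s₀} Ps≡s₀ Pe≡e t⁺≤n₀ (proj₁ dim-d)
      = subst (IsDim F t s) (ℕₚ.≤-antisym (dim≤D d dim-d) D≤d) dim-d
      where
      D≤d : D ≤ d
      D≤d = ℕₚ.≤-trans (ℕₚ.≮⇒≥ (λ k′<D → D-least k′ k′<D fits-k′)) k′≤d

    -- Every column of a distinct solution s* reappears in s, so equal entries of s force equal entries of s*.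
    saturated-distinct : ∀ {n n*} t {s : Vec (Vecs F n) m} {s* : Vec (Vecs F n*) m} →
      Saturated t s → IsDistinctSolution F A s* → ∀ i j → lookup s i ≡ lookup s j → i ≡ j
    saturated-distinct t {s} {s*} saturated (solution* , distinct*) i j sᵢ≡sⱼ =
      distinct* i j (lookup-ext λ c → through-s c (saturated (column c s*) (IsSolution⇒InKernel {s = s*} solution* c)))
      where
      through-s : ∀ c → Σ _ (λ β → _⁺ F t ≤ toℕ β × column β s ≡ column c s*) →
        lookup (lookup s* i) c ≡ lookup (lookup s* j) c
      through-s c (β , _ , sβ≡s*c) = begin
        lookup (lookup s* i) c   ≡⟨ lookup-column c s* i ⟨
        lookup (column c s*) i   ≡⟨ cong (λ w → lookup w i) sβ≡s*c ⟨
        lookup (column β s) i    ≡⟨ lookup-column β s i ⟩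
        lookup (lookup s i) β    ≡⟨ cong (λ w → lookup w β) sᵢ≡sⱼ ⟩
        lookup (lookup s j) β    ≡⟨ lookup-column β s j ⟨
        lookup (column β s) j    ≡⟨ cong (λ w → lookup w j) sβ≡s*c ⟩
        lookup (column c s*) j   ≡⟨ lookup-column c s* j ⟩
        lookup (lookup s* j) c   ∎
        where open ≡-Reasoning

-- ℕ arithmetic is opened only here: the field operations of Linear share its operator names.
open import Data.Nat using (_+_; _*_; _∸_; _^_; ∣_-_∣)

length-cartesianProductWith : (f : X → Y → Z) (xs : List X) (ys : List Y) →
  length (cartesianProductWith f xs ys) ≡ length xs * length ys
length-cartesianProductWith f [] ys = refl
length-cartesianProductWith f (x ∷ xs) ys = begin
  length (List.map (f x) ys List.++ cartesianProductWith f xs ys)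
    ≡⟨ Listₚ.length-++ (List.map (f x) ys) ⟩
  length (List.map (f x) ys) + length (cartesianProductWith f xs ys)
    ≡⟨ cong₂ _+_ (Listₚ.length-map (f x) ys) (length-cartesianProductWith f xs ys) ⟩
  length ys + length xs * length ys ∎
  where open ≡-Reasoning

length-vectors : (xs : List X) → ∀ n → length (vectors xs n) ≡ length xs ^ n
length-vectors xs zero = refl
length-vectors xs (suc n) =
  trans (length-cartesianProductWith _∷_ xs (vectors xs n)) (cong (length xs *_) (length-vectors xs n))

module _ {P : X → Set} (P? : Decidable P) where

  length-filter-∁ : ∀ xs → length (filter P? xs) + length (filter (∁? P?) xs) ≡ length xs
  length-filter-∁ [] = refl
  length-filter-∁ (x ∷ xs) with P? x
  ... | yes _ = cong suc (length-filter-∁ xs)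
  ... | no _ = trans (ℕₚ.+-suc _ _) (cong suc (length-filter-∁ xs))

  length-filter-map≤ : {R : Y → Set} (R? : Decidable R) (f : Y → X) → (∀ y → P (f y) → R y) →
    ∀ ys → length (filter P? (List.map f ys)) ≤ length (filter R? ys)
  length-filter-map≤ R? f P⇒R [] = z≤n
  length-filter-map≤ R? f P⇒R (y ∷ ys) with P? (f y) | R? y
  ... | yes p | yes _ = s≤s (length-filter-map≤ R? f P⇒R ys)
  ... | yes p | no ¬r = contradiction (P⇒R y p) ¬r
  ... | no _  | yes _ = ℕₚ.m≤n⇒m≤1+n (length-filter-map≤ R? f P⇒R ys)
  ... | no _  | no _  = length-filter-map≤ R? f P⇒R ys

  length-filter-∪≤ : {Q R : X → Set} (Q? : Decidable Q) (R? : Decidable R) → (∀ x → P x → Q x ⊎ R x) →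
    ∀ xs → length (filter P? xs) ≤ length (filter Q? xs) + length (filter R? xs)
  length-filter-∪≤ Q? R? P⇒Q∪R [] = z≤n
  length-filter-∪≤ Q? R? P⇒Q∪R (x ∷ xs) with P? x | Q? x | R? x | length-filter-∪≤ Q? R? P⇒Q∪R xs
  ... | yes _ | yes _ | yes _ | ih = s≤s (ℕₚ.≤-trans ih (ℕₚ.+-monoʳ-≤ _ (ℕₚ.n≤1+n _)))
  ... | yes _ | yes _ | no _  | ih = s≤s ih
  ... | yes _ | no _  | yes _ | ih = ℕₚ.≤-trans (s≤s ih) (ℕₚ.≤-reflexive (sym (ℕₚ.+-suc _ _)))
  ... | yes p | no ¬q | no ¬r | _  = ⊥-elim ([ ¬q , ¬r ]′ (P⇒Q∪R x p))
  ... | no _  | yes _ | yes _ | ih = ℕₚ.m≤n⇒m≤1+n (ℕₚ.≤-trans ih (ℕₚ.+-monoʳ-≤ _ (ℕₚ.n≤1+n _)))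
  ... | no _  | yes _ | no _  | ih = ℕₚ.m≤n⇒m≤1+n ih
  ... | no _  | no _  | yes _ | ih = ℕₚ.≤-trans ih (ℕₚ.+-monoʳ-≤ _ (ℕₚ.n≤1+n _))
  ... | no _  | no _  | no _  | ih = ih

module _ {f : X → Y → Z} {P : Z → Set} {Q : X → Set} {R : Y → Set}
         (P? : Decidable P) (Q? : Decidable Q) (R? : Decidable R)
         (P⇒Q×R : ∀ x y → P (f x y) → Q x × R y) where

  length-filter-cartesianProductWith≤ : ∀ xs ys →
    length (filter P? (cartesianProductWith f xs ys)) ≤ length (filter Q? xs) * length (filter R? ys)
  length-filter-cartesianProductWith≤ [] ys = z≤n
  length-filter-cartesianProductWith≤ (x ∷ xs) ys
    rewrite Listₚ.filter-++ P? (List.map (f x) ys) (cartesianProductWith f xs ys)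
          | Listₚ.length-++ (filter P? (List.map (f x) ys)) {filter P? (cartesianProductWith f xs ys)}
    with Q? x
  ... | yes _ = ℕₚ.+-mono-≤ (length-filter-map≤ P? R? (f x) (λ y p → proj₂ (P⇒Q×R x y p)) ys)
                            (length-filter-cartesianProductWith≤ xs ys)
  ... | no ¬q = ℕₚ.≤-trans (ℕₚ.≤-reflexive (cong (λ zs → length zs + _) (Listₚ.filter-none P? (All.tabulate ¬P))))
                            (length-filter-cartesianProductWith≤ xs ys)
    where
    ¬P : ∀ {z} → z ∈ List.map (f x) ys → ¬ P z
    ¬P z∈ with ∈ₚ.∈-map⁻ (f x) z∈
    ... | y , _ , refl = λ p → ¬q (proj₁ (P⇒Q×R x y p))

module _ {Q : Y → X → Set} (Q? : ∀ y → Decidable (Q y)) where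

  length-filter-⋃≤ : {P : X → Set} (P? : Decidable P) (xs : List X) (ys : List Y) →
    (∀ {x} → P x → Any (λ y → Q y x) ys) →
    ∀ {B} → All (λ y → length (filter (Q? y) xs) ≤ B) ys → length (filter P? xs) ≤ length ys * B
  length-filter-⋃≤ P? xs [] P⇒Q _ =
    ℕₚ.≤-reflexive (cong length (Listₚ.filter-none P? {xs} (All.tabulate (λ _ p → case P⇒Q p of λ ()))))
  length-filter-⋃≤ {P} P? xs (y ∷ ys) P⇒Q (bound ∷ bounds) =
    ℕₚ.≤-trans (length-filter-∪≤ P? (Q? y) P∖Q? split xs)
               (ℕₚ.+-mono-≤ bound (length-filter-⋃≤ P∖Q? xs ys P∖Q⇒Q bounds))
    where
    P∖Q? : Decidable (λ x → P x × ¬ Q y x)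
    P∖Q? x = P? x ×-dec ¬? (Q? y x)
    split : ∀ x → P x → Q y x ⊎ (P x × ¬ Q y x)
    split x p with Q? y x
    ... | yes q = inj₁ q
    ... | no ¬q = inj₂ (p , ¬q)
    P∖Q⇒Q : ∀ {x} → P x × ¬ Q y x → Any (λ y → Q y x) ys
    P∖Q⇒Q (p , ¬q) with P⇒Q p
    ... | here q = contradiction q ¬q
    ... | there q = q

[d+e]*d^e≤[1+d]^e*d : ∀ d e → (d + e) * d ^ e ≤ suc d ^ e * d
[d+e]*d^e≤[1+d]^e*d d zero = ℕₚ.≤-reflexive (base d)
  where
  base : ∀ d → (d + 0) * 1 ≡ 1 * d
  base = solve-∀
[d+e]*d^e≤[1+d]^e*d d (suc e) = begin
  (d + suc e) * (d * d ^ e)       ≡⟨ ℕₚ.*-assoc (d + suc e) d (d ^ e) ⟨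
  ((d + suc e) * d) * d ^ e       ≤⟨ ℕₚ.*-monoˡ-≤ (d ^ e) step ⟩
  (suc d * (d + e)) * d ^ e       ≡⟨ ℕₚ.*-assoc (suc d) (d + e) (d ^ e) ⟩
  suc d * ((d + e) * d ^ e)       ≤⟨ ℕₚ.*-monoʳ-≤ (suc d) ([d+e]*d^e≤[1+d]^e*d d e) ⟩
  suc d * (suc d ^ e * d)         ≡⟨ ℕₚ.*-assoc (suc d) (suc d ^ e) d ⟨
  (suc d * suc d ^ e) * d         ∎
  where
  open ℕₚ.≤-Reasoning
  expand : ∀ d e → (d + suc e) * d + e ≡ suc d * (d + e)
  expand = solve-∀
  step : (d + suc e) * d ≤ suc d * (d + e)
  step = ℕₚ.≤-trans (ℕₚ.m≤m+n _ e) (ℕₚ.≤-reflexive (expand d e))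

*^≤suc^ : ∀ c d e → c * d < e → c * d ^ e ≤ suc d ^ e
*^≤suc^ c zero (suc e) _ = ℕₚ.≤-trans (ℕₚ.≤-reflexive (ℕₚ.*-zeroʳ c)) z≤n
*^≤suc^ c d@(suc _) e cd<e = ℕₚ.*-cancelʳ-≤ (c * d ^ e) (suc d ^ e) d (begin
  c * d ^ e * d       ≡⟨ swap c d (d ^ e) ⟩
  (c * d) * d ^ e     ≤⟨ ℕₚ.*-monoˡ-≤ (d ^ e) (ℕₚ.≤-trans (ℕₚ.m≤n+m (c * d) d) (ℕₚ.+-monoʳ-≤ d (ℕₚ.<⇒≤ cd<e))) ⟩
  (d + e) * d ^ e     ≤⟨ [d+e]*d^e≤[1+d]^e*d d e ⟩
  suc d ^ e * d       ∎)
  where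
  open ℕₚ.≤-Reasoning
  swap : ∀ c d x → c * x * d ≡ (c * d) * x
  swap = solve-∀

∣-∣≤-squeezed : ∀ {g e a b} → g ≤ a → a ≤ g + e → g ≤ b → b ≤ g + e → ∣ a - b ∣ ≤ e
∣-∣≤-squeezed {g} {e} {a} {b} g≤a a≤g+e g≤b b≤g+e with ℕₚ.≤-total a b
... | inj₁ a≤b = begin
  ∣ a - b ∣       ≡⟨ ℕₚ.m≤n⇒∣m-n∣≡n∸m a≤b ⟩
  b ∸ a           ≤⟨ ℕₚ.∸-mono b≤g+e g≤a ⟩
  (g + e) ∸ g     ≡⟨ ℕₚ.m+n∸m≡n g e ⟩
  e               ∎
  where open ℕₚ.≤-Reasoning
... | inj₂ b≤a = begin
  ∣ a - b ∣       ≡⟨ ℕₚ.m≤n⇒∣n-m∣≡n∸m b≤a ⟩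
  a ∸ b           ≤⟨ ℕₚ.∸-mono a≤g+e g≤b ⟩
  (g + e) ∸ g     ≡⟨ ℕₚ.m+n∸m≡n g e ⟩
  e               ∎
  where open ℕₚ.≤-Reasoning

*∣-∣≤-squeezed : ∀ k {g e a b} → g ≤ a → a ≤ g + e → g ≤ b → b ≤ g + e →
  suc (suc k) * e ≤ g + e → suc k * ∣ a - b ∣ ≤ b
*∣-∣≤-squeezed k {g} {e} {a} {b} g≤a a≤g+e g≤b b≤g+e small = begin
  suc k * ∣ a - b ∣   ≤⟨ ℕₚ.*-monoʳ-≤ (suc k) (∣-∣≤-squeezed g≤a a≤g+e g≤b b≤g+e) ⟩
  suc k * e           ≤⟨ ℕₚ.+-cancelˡ-≤ e _ _ (ℕₚ.≤-trans small (ℕₚ.≤-reflexive (ℕₚ.+-comm g e))) ⟩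
  g                   ≤⟨ g≤b ⟩
  b                   ∎
  where open ℕₚ.≤-Reasoning

module _ {X : Set} (_≟ₓ_ : (x y : X) → Dec (x ≡ y)) where

  Avoids : X → ℕ → ∀ {n} → Vec X n → Set
  Avoids v T {n} w = ∀ (c : Fin n) → T ≤ toℕ c → lookup w c ≢ v

  avoids? : ∀ v T {n} → Decidable (Avoids v T {n})
  avoids? v T w = Finₚ.all? (λ c → (T ≤? toℕ c) →-dec ¬? (lookup w c ≟ₓ v))

  length-avoiding≤ : ∀ {xs v} → v ∈ xs → ∀ T n →
    length (filter (avoids? v T) (vectors xs n)) ≤ length xs ^ T * pred (length xs) ^ (n ∸ T)
  length-avoiding≤ {xs@(_ ∷ _)} {v} v∈xs T zero = begin
    length (filter (avoids? v T) (vectors xs 0))   ≤⟨ Listₚ.length-filter (avoids? v T) (vectors xs 0) ⟩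
    1                                              ≤⟨ ℕₚ.m^n>0 (length xs) T ⟩
    length xs ^ T                                  ≡⟨ ℕₚ.*-identityʳ _ ⟨
    length xs ^ T * 1                              ≡⟨ cong (λ e → length xs ^ T * pred (length xs) ^ e) (ℕₚ.0∸n≡0 T) ⟨
    length xs ^ T * pred (length xs) ^ (0 ∸ T)     ∎
    where open ℕₚ.≤-Reasoning
  length-avoiding≤ {xs} {v} v∈xs zero (suc n) = begin
    length (filter (avoids? v 0) (vectors xs (suc n)))
      ≤⟨ length-filter-cartesianProductWith≤ (avoids? v 0) (λ x → ¬? (x ≟ₓ v)) (avoids? v 0)
           (λ x w avoids → avoids Fin.zero z≤n , λ c _ → avoids (Fin.suc c) z≤n) xs (vectors xs n) ⟩
    length (filter (λ x → ¬? (x ≟ₓ v)) xs) * length (filter (avoids? v 0) (vectors xs n))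
      ≤⟨ ℕₚ.*-mono-≤ (ℕₚ.<⇒≤pred (Listₚ.filter-notAll (λ x → ¬? (x ≟ₓ v)) xs (Any.map (λ x≡v x≢v → x≢v (sym x≡v)) v∈xs)))
                     (length-avoiding≤ v∈xs 0 n) ⟩
    pred (length xs) * (1 * pred (length xs) ^ n)
      ≡⟨ cong (pred (length xs) *_) (ℕₚ.*-identityˡ _) ⟩
    pred (length xs) ^ suc n
      ≡⟨ ℕₚ.*-identityˡ _ ⟨
    1 * pred (length xs) ^ suc n ∎
    where open ℕₚ.≤-Reasoning
  length-avoiding≤ {xs} {v} v∈xs (suc T) (suc n) = begin
    length (filter (avoids? v (suc T)) (vectors xs (suc n)))
      ≤⟨ length-filter-cartesianProductWith≤ (avoids? v (suc T)) U? (avoids? v T)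
           (λ x w avoids → _ , λ c T≤c → avoids (Fin.suc c) (s≤s T≤c)) xs (vectors xs n) ⟩
    length (filter U? xs) * length (filter (avoids? v T) (vectors xs n))
      ≤⟨ ℕₚ.*-mono-≤ (ℕₚ.≤-reflexive (cong length (Listₚ.filter-all U? (All.universal-U xs))))
                     (length-avoiding≤ v∈xs T n) ⟩
    length xs * (length xs ^ T * pred (length xs) ^ (n ∸ T))
      ≡⟨ ℕₚ.*-assoc (length xs) (length xs ^ T) _ ⟨
    length xs ^ suc T * pred (length xs) ^ (suc n ∸ suc T) ∎
    where open ℕₚ.≤-Reasoning

*^*pred^≤^ : ∀ c κ T n → 1 ≤ κ → suc (T + c * pred κ) ≤ n → c * (κ ^ T * pred κ ^ (n ∸ T)) ≤ κ ^ n
*^*pred^≤^ c (suc d) T n _ T+cd<n = begin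
  c * (suc d ^ T * d ^ (n ∸ T))      ≡⟨ ℕₚ.*-assoc c (suc d ^ T) _ ⟨
  c * suc d ^ T * d ^ (n ∸ T)        ≡⟨ cong (_* d ^ (n ∸ T)) (ℕₚ.*-comm c (suc d ^ T)) ⟩
  suc d ^ T * c * d ^ (n ∸ T)        ≡⟨ ℕₚ.*-assoc (suc d ^ T) c _ ⟩
  suc d ^ T * (c * d ^ (n ∸ T))      ≤⟨ ℕₚ.*-monoʳ-≤ (suc d ^ T) (*^≤suc^ c d (n ∸ T) cd<n∸T) ⟩
  suc d ^ T * suc d ^ (n ∸ T)        ≡⟨ ℕₚ.^-distribˡ-+-* (suc d) T (n ∸ T) ⟨
  suc d ^ (T + (n ∸ T))              ≡⟨ cong (suc d ^_) (ℕₚ.m+[n∸m]≡n (ℕₚ.≤-trans (ℕₚ.m≤m+n T _) (ℕₚ.<⇒≤ T+cd<n))) ⟩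
  suc d ^ n                          ∎
  where
  open ℕₚ.≤-Reasoning
  cd<n∸T : c * d < n ∸ T
  cd<n∸T = ℕₚ.m+n≤o⇒m≤o∸n (suc (c * d)) (subst (_≤ n) (cong suc (ℕₚ.+-comm T (c * d))) T+cd<n)

module Counting (F : FiniteField) {r m : ℕ} (A : Fin r → Fin m → ℤ) where
  open FiniteField F using (0#) renaming (Carrier to C)
  open Linear F

  kernel : List (Vec C m)
  kernel = filter (inKernel? A) (elements (vectorsOf m))

  κ : ℕ
  κ = length kernel

  kernel-unique : Unique kernel
  kernel-unique = Uniqueₚ.filter⁺ (inKernel? A) (vectors⁺ elements-unique m)

  ∈-kernel⁺ : ∀ {v} → InKernel A v → v ∈ kernel
  ∈-kernel⁺ {v} v∈K = ∈ₚ.∈-filter⁺ (inKernel? A) (complete (vectorsOf m) v) v∈K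

  ∈-kernel⁻ : ∀ {v} → v ∈ kernel → InKernel A v
  ∈-kernel⁻ v∈kernel = proj₂ (∈ₚ.∈-filter⁻ (inKernel? A) {xs = elements (vectorsOf m)} v∈kernel)

  1≤κ : 1 ≤ κ
  1≤κ = ∈⇒1≤length (∈-kernel⁺ {Vec.replicate m 0#} (InKernel-zero A))

  fromColumns : ∀ {n} → Vec (Vec C m) n → Vec (Vecs F n) m
  fromColumns X = tabulate (λ j → tabulate (λ c → lookup (lookup X c) j))

  column-fromColumns : ∀ {n} (X : Vec (Vec C m) n) c → column c (fromColumns X) ≡ lookup X c
  column-fromColumns X c = lookup-ext λ j →
    trans (lookup-column c (fromColumns X) j)
      (trans (cong (λ row → lookup row c) (Vecₚ.lookup∘tabulate _ j)) (Vecₚ.lookup∘tabulate _ c))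

  fromColumns-injective : ∀ {n} {X Y : Vec (Vec C m) n} → fromColumns X ≡ fromColumns Y → X ≡ Y
  fromColumns-injective {X = X} {Y} e = lookup-ext λ c →
    trans (sym (column-fromColumns X c)) (trans (cong (column c) e) (column-fromColumns Y c))

  fromColumns-columns : ∀ {n} (s : Vec (Vecs F n) m) → fromColumns (tabulate (λ c → column c s)) ≡ s
  fromColumns-columns s = lookup-ext λ j → lookup-ext λ c → begin
    lookup (lookup (fromColumns columns) j) c   ≡⟨ lookup-column c (fromColumns columns) j ⟨
    lookup (column c (fromColumns columns)) j
      ≡⟨ cong (λ v → lookup v j) (trans (column-fromColumns columns c) (Vecₚ.lookup∘tabulate (λ c → column c s) c)) ⟩
    lookup (column c s) j
      ≡⟨ lookup-column c s j ⟩
    lookup (lookup s j) c ∎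
    where
    open ≡-Reasoning
    columns = tabulate (λ c → column c s)

  solutions : ∀ n → List (Vec (Vecs F n) m)
  solutions n = List.map fromColumns (vectors kernel n)

  length-solutions : ∀ n → length (solutions n) ≡ length (vectors kernel n)
  length-solutions n = Listₚ.length-map fromColumns (vectors kernel n)

  fromColumns-IsSolution : ∀ {n} {X : Vec (Vec C m) n} → X ∈ vectors kernel n → IsSolution F A (fromColumns X)
  fromColumns-IsSolution {X = X} X∈ = InKernel⇒IsSolution A {s = fromColumns X} λ c →
    subst (InKernel A) (sym (column-fromColumns X c)) (∈-kernel⁻ (∈-vectors⁻ kernel X X∈ c))

  ∈-solutions : ∀ {n} {s : Vec (Vecs F n) m} → IsSolution F A s → s ∈ solutions n
  ∈-solutions {n} {s} solution = subst (_∈ solutions n) (fromColumns-columns s) (∈ₚ.∈-map⁺ fromColumns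
    (∈-vectors⁺ kernel columns λ c → subst (_∈ kernel) (sym (Vecₚ.lookup∘tabulate (λ c → column c s) c))
                                  (∈-kernel⁺ {column c s} (IsSolution⇒InKernel A {s = s} solution c))))
    where columns = tabulate (λ c → column c s)

  module _ (t : ℤ) where

    HasAllColumns : ∀ {n} → Vec (Vec C m) n → Set
    HasAllColumns {n} X = All (λ v → Σ (Fin n) λ c → _⁺ F t ≤ toℕ c × lookup X c ≡ v) kernel

    hasAllColumns? : ∀ {n} → Decidable (HasAllColumns {n})
    hasAllColumns? X = All.all? (λ v → Finₚ.any? λ c → (_⁺ F t ≤? toℕ c) ×-dec (lookup X c ≟ᵥ v)) kernel

    HasAllColumns⇒Saturated : ∀ {n} {X : Vec (Vec C m) n} → HasAllColumns X → Saturated A t (fromColumns X)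
    HasAllColumns⇒Saturated {X = X} has v v∈K with c , t⁺≤c , Xc≡v ← All.lookup has (∈-kernel⁺ {v} v∈K) =
      c , t⁺≤c , trans (column-fromColumns X c) Xc≡v

    saturated unsaturated : ∀ n → List (Vec (Vec C m) n)
    saturated n = filter hasAllColumns? (vectors kernel n)
    unsaturated n = filter (∁? hasAllColumns?) (vectors kernel n)

    length-saturated+unsaturated : ∀ n → length (saturated n) + length (unsaturated n) ≡ κ ^ n
    length-saturated+unsaturated n = trans (length-filter-∁ hasAllColumns? (vectors kernel n)) (length-vectors kernel n)

    length-unsaturated≤ : ∀ n → length (unsaturated n) ≤ κ * (κ ^ _⁺ F t * pred κ ^ (n ∸ _⁺ F t))
    length-unsaturated≤ n =
      length-filter-⋃≤ (λ v → avoids? _≟ᵥ_ v (_⁺ F t)) (∁? hasAllColumns?) (vectors kernel n) kernel (λ {X} → missing {X})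
        (All.tabulate λ v∈kernel → length-avoiding≤ _≟ᵥ_ v∈kernel (_⁺ F t) n)
      where
      missing : ∀ {X} → ¬ HasAllColumns X → Any (λ v → Avoids _≟ᵥ_ v (_⁺ F t) X) kernel
      missing {X} ¬has = Any.map (λ ¬found c t⁺≤c Xc≡v → ¬found (c , t⁺≤c , Xc≡v))
        (Allₚ.¬All⇒Any¬ (λ v → Finₚ.any? λ c → (_⁺ F t ≤? toℕ c) ×-dec (lookup X c ≟ᵥ v)) kernel ¬has)

    threshold : ℕ → ℕ
    threshold k = suc (_⁺ F t + suc (suc k) * κ * pred κ)

    threshold⇒t⁺≤ : ∀ {k n} → threshold k ≤ n → _⁺ F t ≤ n
    threshold⇒t⁺≤ th≤n = ℕₚ.≤-trans (ℕₚ.m≤m+n (_⁺ F t) _) (ℕₚ.<⇒≤ th≤n)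

    unsaturated-negligible : ∀ k n → threshold k ≤ n → suc (suc k) * length (unsaturated n) ≤ κ ^ n
    unsaturated-negligible k n th≤n = begin
      suc (suc k) * length (unsaturated n)                       ≤⟨ ℕₚ.*-monoʳ-≤ (suc (suc k)) (length-unsaturated≤ n) ⟩
      suc (suc k) * (κ * (κ ^ _⁺ F t * pred κ ^ (n ∸ _⁺ F t)))   ≡⟨ ℕₚ.*-assoc (suc (suc k)) κ _ ⟨
      suc (suc k) * κ * (κ ^ _⁺ F t * pred κ ^ (n ∸ _⁺ F t))     ≤⟨ *^*pred^≤^ (suc (suc k) * κ) κ (_⁺ F t) n 1≤κ th≤n ⟩
      κ ^ n                                                      ∎
      where open ℕₚ.≤-Reasoning

    module _ {n : ℕ} {P : Vec (Vecs F n) m → Set} {c : ℕ} (card : HasCard P c) where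

      saturated≤ : All P (List.map fromColumns (saturated n)) → length (saturated n) ≤ c
      saturated≤ all = subst (_≤ c) (Listₚ.length-map fromColumns (saturated n))
        (HasCard⇒length≤ card (Uniqueₚ.map⁺ fromColumns-injective
                                 (Uniqueₚ.filter⁺ hasAllColumns? (vectors⁺ kernel-unique n))) all)

      ≤saturated+unsaturated : (∀ {s} → P s → IsSolution F A s) → c ≤ length (saturated n) + length (unsaturated n)
      ≤saturated+unsaturated P⇒solution = subst (c ≤_)
        (trans (length-solutions n) (sym (length-filter-∁ hasAllColumns? (vectors kernel n))))
        (HasCard⇒≤length card (solutions n) (∈-solutions ∘ P⇒solution))

    saturated-good : ∀ D {n n₀ n*} {s₀ : Vec (Vecs F n₀) m} {s* : Vec (Vecs F n*) m} →
      IsSolution F A s₀ → _⁺ F t ≤ n₀ → IsDim F t s₀ D →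
      (∀ n → _⁺ F t ≤ n → ∀ (s : Vec (Vecs F n) m) → IsSolution F A s → ∀ d → IsDim F t s d → d ≤ D) →
      IsDistinctSolution F A s* → _⁺ F t ≤ n →
      All (λ s → IsTSolution F t A D s × IsDistinctSolution F A s) (List.map fromColumns (saturated n))
    saturated-good D {n} {s₀ = s₀} {s*} solution₀ t⁺≤n₀ dim₀ dim≤D distinct* t⁺≤n = Allₚ.map⁺ (All.tabulate good)
      where
      good : ∀ {X} → X ∈ saturated n → IsTSolution F t A D (fromColumns X) × IsDistinctSolution F A (fromColumns X)
      good {X} X∈ with X∈vectors , has ← ∈ₚ.∈-filter⁻ hasAllColumns? {xs = vectors kernel n} X∈ =
        (solution , saturated-dim A t D {s = fromColumns X} {s₀} X-saturated solution t⁺≤n solution₀ t⁺≤n₀ dim₀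
                                     (dim≤D n t⁺≤n (fromColumns X) solution)) ,
        (solution , saturated-distinct A t {s = fromColumns X} {s*} X-saturated distinct*)
        where
        solution = fromColumns-IsSolution X∈vectors
        X-saturated = HasAllColumns⇒Saturated {X = X} has

-- The hypotheses on q, on the rank and entries of A and on the admissibility of t go unused: dim_t(L) is
-- supplied as a maximum (IsDimL), and saturated solutions attain it.
proposition2p8 :
    (F : FiniteField) → IsPrimePower (FiniteField.size F) →
    (r m : ℕ) (A : Fin r → Fin m → ℤ) →
    FullRank F A →
    (∀ i j → Coprime ∣ A i j ∣ (FiniteField.size F)) →
    (Σ ℕ λ n → Σ (Vec (Vecs F n) m) λ s → IsDistinctSolution F A s) →
    (t : ℤ) → -[1+ 0 ] ℤ.≤ t → Admissible F t A →
    (D : ℕ) → IsDimL F t A D →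
    (a b : ℕ → ℕ) →
    (∀ n → HasCard (IsTSolution F {n = n} t A D) (a n)) →
    (∀ n → HasCard (IsDistinctSolution F {n = n} A) (b n)) →
    ∀ (k : ℕ) → Σ ℕ λ N → ∀ n → N ≤ n → suc k * ∣ a n - b n ∣ ≤ b n
proposition2p8 F _ r m A _ _ (_ , s* , distinct*) t _ _ D (dim≤D , _ , t⁺≤n₀ , s₀ , solution₀ , dim₀)
               a b card-a card-b k = threshold t k , squeezed
  where
  open Counting F A
  squeezed : ∀ n → threshold t k ≤ n → suc k * ∣ a n - b n ∣ ≤ b n
  squeezed n th≤n = *∣-∣≤-squeezed k
    (saturated≤ t (card-a n) (All.map proj₁ good)) (≤saturated+unsaturated t (card-a n) proj₁)
    (saturated≤ t (card-b n) (All.map proj₂ good)) (≤saturated+unsaturated t (card-b n) proj₁)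
    (ℕₚ.≤-trans (unsaturated-negligible t k n th≤n) (ℕₚ.≤-reflexive (sym (length-saturated+unsaturated t n))))
    where good = saturated-good t D {s₀ = s₀} {s* = s*} solution₀ t⁺≤n₀ dim₀ dim≤D distinct* (threshold⇒t⁺≤ t {k} th≤n)
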